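{- Let $\ell\ge1$ be an integer and let $G$ be a digraph whose underlying undirected graph $\mathrm{un}(G)$ has no subgraph isomorphic to $K_{\ell,\ell}$. Then $\mathrm{d\text{ - }pw}(G)\le\mathrm{pw}(\mathrm{un}(G))\le 2\cdot\mathrm{lnlcw}(\mathrm{un}(G))(\ell-1)\le 2\cdot\mathrm{d\text{ - }lnlcw}(G)(\ell-1)$.
   Context: Digraphs $G=(V,E)$ are finite with $E\subseteq\{(u,v):u\ne v\}$; $\mathrm{un}(G)=(V,\{\{u,v\}:(u,v)\in E\text{ or }(v,u)\in E\})$. $\mathrm{d\text{ - }pw}(G)$ is the minimum of $\max|X_i|-1$ over sequences $(X_1,\dots,X_r)$ of subsets of $V$ with $\bigcup X_i=V$, for each $(u,v)\in E$ some $i\le j$ with $u\in X_i,v\in X_j$, and $X_i\cap X_\ell\subseteq X_j$ for $i<j<\ell$; for an undirected graph, $\mathrm{pw}$ is defined in the same way with each edge required to lie in a single bag. $\mathrm{d\text{ - }lnlcw}(G)$ is the least $k$ such that $G$ (under some labeling, labels then forgotten) is built from labeled digraphs with labels in $[k]$ by: $\bullet_a$ (a vertex labeled $a$); $H\otimes_{(\overrightarrow S,\overleftarrow S)}\bullet_a$ ($\overrightarrow S,\overleftarrow S\subseteq[k]^2$): add a new vertex $v$ labeled $a$ plus arcs $(u,v)$ for $u$ in $H$ of label $b$ with $(b,a)\in\overrightarrow S$ and arcs $(v,u)$ for $u$ in $H$ of label $b$ with $(b,a)\in\overleftarrow S$; $\circ_R$ ($R:[k]\to[k]$, relabel $a$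 to $R(a)$). For undirected graphs, $\mathrm{lnlcw}$ is defined the same way with the operation $H\times_S\bullet_a$ ($S\subseteq[k]^2$) adding an edge between the new vertex and every vertex of label $b$ with $(b,a)\in S$. $K_{\ell,\ell}$ is the complete bipartite graph with both sides of size $\ell$. -}

module Defs where

open import Data.Nat using (ℕ; zero; suc; _≤_)
open import Data.Bool using (Bool; true; false; _∨_)
open import Data.Fin using (Fin; zero; suc; _<_)
import Data.Fin as F
open import Data.Fin.Subset using (Subset; _∈_; ∣_∣)
open import Data.Fin.Permutation using (Permutation′; _⟨$⟩ʳ_)
open import Data.Product using (Σ; ∃; _×_; _,_)
open import Relation.Binary.PropositionalEquality using (_≡_; _≢_)

record Digraph : Set where
  field
    n     : ℕ
    arc   : Fin n → Fin n → Bool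
    loopless : ∀ u → arc u u ≡ false
open Digraph public

record Graph : Set where
  field
    n     : ℕ
    adj   : Fin n → Fin n → Bool
    sym   : ∀ u v → adj u v ≡ adj v u
    loopless : ∀ u → adj u u ≡ false
open Graph public

un : Digraph → Graph
un G = record
  { n = Digraph.n G
  ; adj = λ u v → Digraph.arc G u v ∨ Digraph.arc G v u
  ; sym = λ u v → ∨-comm' (Digraph.arc G u v) (Digraph.arc G v u)
  ; loopless = λ u → lp u
  }
  where
    ∨-comm' : ∀ a b → (a ∨ b) ≡ (b ∨ a)
    ∨-comm' false false = _≡_.refl
    ∨-comm' false true  = _≡_.refl
    ∨-comm' true  false = _≡_.refl
    ∨-comm' true  true  = _≡_.refl
    lp : ∀ u → (Digraph.arc G u u ∨ Digraph.arc G u u) ≡ false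
    lp u with Digraph.arc G u u | Digraph.loopless G u
    ... | false | _ = _≡_.refl

HasKll : Graph → ℕ → Set
HasKll H ℓ =
  Σ (Fin ℓ → Fin (Graph.n H)) λ a →
  Σ (Fin ℓ → Fin (Graph.n H)) λ b →
    (∀ i j → a i ≡ a j → i ≡ j) ×
    (∀ i j → b i ≡ b j → i ≡ j) ×
    (∀ i j → a i ≢ b j) ×
    (∀ i j → Graph.adj H (a i) (b j) ≡ true)

record DPathDecomp (G : Digraph) (k : ℕ) : Set where
  field
    r     : ℕ
    bag   : Fin r → Subset (Digraph.n G)
    cover : ∀ v → ∃ λ i → v ∈ bag i
    arcs  : ∀ u v → Digraph.arc G u v ≡ true →
              ∃ λ i → ∃ λ j → (i F.≤ j) × (u ∈ bag i) × (v ∈ bag j)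
    interp : ∀ i j l → i < j → j < l → ∀ v → v ∈ bag i → v ∈ bag l → v ∈ bag j
    width : ∀ i → ∣ bag i ∣ ≤ suc k

record PathDecomp (H : Graph) (k : ℕ) : Set where
  field
    r     : ℕ
    bag   : Fin r → Subset (Graph.n H)
    cover : ∀ v → ∃ λ i → v ∈ bag i
    edges : ∀ u v → Graph.adj H u v ≡ true → ∃ λ i → (u ∈ bag i) × (v ∈ bag i)
    interp : ∀ i j l → i < j → j < l → ∀ v → v ∈ bag i → v ∈ bag l → v ∈ bag j
    width : ∀ i → ∣ bag i ∣ ≤ suc k

DPW≤ : Digraph → ℕ → Set
DPW≤ G k = DPathDecomp G k

PW≤ : Graph → ℕ → Set
PW≤ H k = PathDecomp H k

-- Linear NLC expressions with labels in Fin k, producing a labeled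
-- (di)graph on vertex set Fin n.  The vertex added last is `zero`,
-- older vertices are shifted by `suc`.

data DExpr (k : ℕ) : ℕ → Set where
  single : Fin k → DExpr k 1
  add    : ∀ {m} → DExpr k m → (Sf Sb : Fin k → Fin k → Bool) → Fin k → DExpr k (suc m)
  relab  : ∀ {m} → (Fin k → Fin k) → DExpr k m → DExpr k m

dlabel : ∀ {k m} → DExpr k m → Fin m → Fin k
dlabel (single a) zero = a
dlabel (add e Sf Sb a) zero = a
dlabel (add e Sf Sb a) (suc u) = dlabel e u
dlabel (relab R e) u = R (dlabel e u)

-- Sf b a = true  iff (b,a) ∈ S→ : arcs (u,v) from old u of label b to new v
-- Sb b a = true  iff (b,a) ∈ S← : arcs (v,u) from new v to old u of label b
darc : ∀ {k m} → DExpr k m → Fin m → Fin m → Bool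
darc (single a) _ _ = false
darc (add e Sf Sb a) zero zero = false
darc (add e Sf Sb a) zero (suc u) = Sb (dlabel e u) a
darc (add e Sf Sb a) (suc u) zero = Sf (dlabel e u) a
darc (add e Sf Sb a) (suc u) (suc w) = darc e u w
darc (relab R e) u w = darc e u w

data UExpr (k : ℕ) : ℕ → Set where
  single : Fin k → UExpr k 1
  add    : ∀ {m} → UExpr k m → (S : Fin k → Fin k → Bool) → Fin k → UExpr k (suc m)
  relab  : ∀ {m} → (Fin k → Fin k) → UExpr k m → UExpr k m

ulabel : ∀ {k m} → UExpr k m → Fin m → Fin k
ulabel (single a) zero = a
ulabel (add e S a) zero = a
ulabel (add e S a) (suc u) = ulabel e u
ulabel (relab R e) u = R (ulabel e u)

uadj : ∀ {k m} → UExpr k m → Fin m → Fin m → Bool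
uadj (single a) _ _ = false
uadj (add e S a) zero zero = false
uadj (add e S a) zero (suc u) = S (ulabel e u) a
uadj (add e S a) (suc u) zero = S (ulabel e u) a
uadj (add e S a) (suc u) (suc w) = uadj e u w
uadj (relab R e) u w = uadj e u w

DLNLCW≤ : Digraph → ℕ → Set
DLNLCW≤ G k = Σ (DExpr k (Digraph.n G)) λ e → Σ (Permutation′ (Digraph.n G)) λ π →
  ∀ u v → darc e (π ⟨$⟩ʳ u) (π ⟨$⟩ʳ v) ≡ Digraph.arc G u v

LNLCW≤ : Graph → ℕ → Set
LNLCW≤ H k = Σ (UExpr k (Graph.n H)) λ e → Σ (Permutation′ (Graph.n H)) λ π →
  ∀ u v → uadj e (π ⟨$⟩ʳ u) (π ⟨$⟩ʳ v) ≡ Graph.adj H u v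

module Submission where

-- The first and third inequalities are bookkeeping: an undirected path
-- decomposition of un(G) is a directed one of G, and forgetting arc
-- directions turns a directed linear NLC expression for G into an
-- undirected one for un(G) with the same labels.
--
-- The middle one is the content.  Number the vertices of a linear NLC
-- expression from the newest (0) to the oldest, and let stage j be the
-- moment when exactly the vertices of index ≥ j exist.  At stage j each
-- label class is small (< ℓ) or is watched (completely joined to) by fewer
-- than ℓ later vertices, as otherwise a K_{ℓ,ℓ} appears.  Collecting the
-- small sets gives separators Sep j of size ≤ k(ℓ-1), and the bags
-- {x} ∪ Sep x ∪ Sep (x+1) form a path decomposition of width ≤ 2k(ℓ-1).
-- Interpolation holds because classes only merge as time goes on, so a
-- vertex stays in the separators between its insertion and any stage at
-- which it is a separator vertex.  Everything is done for the graph of the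
-- expression and pulled back to un(G) along the isomorphism.

open import Defs hiding (sym)
open import Data.Nat as ℕ using (ℕ; zero; suc; _≤_; _<_; _*_; _∸_; _+_; z≤n; s≤s)
import Data.Nat.Properties as ℕₚ
open import Data.Fin as Fin using (Fin; zero; suc; toℕ)
import Data.Fin.Properties as Finₚ
open import Data.Fin.Subset using (Subset; _∈_; _⊆_; ∣_∣; _∪_; ⁅_⁆; ⊥; _-_)
import Data.Fin.Subset.Properties as Subₚ
open import Data.Fin.Permutation using (Permutation; _⟨$⟩ʳ_; _⟨$⟩ˡ_; inverseʳ; inverseˡ)
open import Data.Vec using ([]; _∷_; tabulate; here; there)
import Data.Vec.Properties as Vecₚ
open import Data.Bool using (true; false; _∨_)
import Data.Bool.Properties as Boolₚ
open import Data.Product using (Σ; ∃; _×_; _,_; proj₁; proj₂)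
open import Data.Sum using (_⊎_; inj₁; inj₂)
open import Function using (_∘_)
open import Function.Definitions using (Injective)
open import Relation.Binary using (tri<; tri≈; tri>)
open import Relation.Binary.PropositionalEquality
  using (_≡_; _≢_; refl; sym; trans; cong; cong₂; subst)
open import Relation.Nullary using (¬_; Dec; yes; no; does; contradiction)
open import Relation.Nullary.Decidable using (dec-true; _×-dec_; _⊎-dec_; _→-dec_; ¬?)

⟪_⟫ : ∀ {m} {P : Fin m → Set} → (∀ x → Dec (P x)) → Subset m
⟪ P? ⟫ = tabulate (λ x → does (P? x))

∈⟪⟫⁺ : ∀ {m} {P : Fin m → Set} (P? : ∀ x → Dec (P x)) {x} → P x → x ∈ ⟪ P? ⟫
∈⟪⟫⁺ P? {x} p =
  Vecₚ.lookup⇒[]= x _ (trans (Vecₚ.lookup∘tabulate (does ∘ P?) x) (dec-true (P? x) p))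

∈⟪⟫⁻ : ∀ {m} {P : Fin m → Set} (P? : ∀ x → Dec (P x)) {x} → x ∈ ⟪ P? ⟫ → P x
∈⟪⟫⁻ P? {x} x∈ =
  witness (P? x) (trans (sym (Vecₚ.lookup∘tabulate (does ∘ P?) x)) (Vecₚ.[]=⇒lookup x∈))
  where
    witness : ∀ {A : Set} (A? : Dec A) → does A? ≡ true → A
    witness (yes a) _ = a

∣p∣≤∣q∣-injection : ∀ {a b} (f : Fin a → Fin b) → Injective _≡_ _≡_ f →
  (p : Subset a) (q : Subset b) → (∀ {i} → i ∈ p → f i ∈ q) → ∣ p ∣ ≤ ∣ q ∣
∣p∣≤∣q∣-injection f f-inj [] q p→q = z≤n
∣p∣≤∣q∣-injection f f-inj (false ∷ p) q p→q =
  ∣p∣≤∣q∣-injection (f ∘ suc) (Finₚ.suc-injective ∘ f-inj) p q (p→q ∘ there)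
∣p∣≤∣q∣-injection f f-inj (true ∷ p) q p→q =
  ℕₚ.≤-<-trans p≤q-f₀ (Subₚ.x∈p⇒∣p-x∣<∣p∣ (p→q here))
  where
    p≤q-f₀ : ∣ p ∣ ≤ ∣ q - f zero ∣
    p≤q-f₀ = ∣p∣≤∣q∣-injection (f ∘ suc) (Finₚ.suc-injective ∘ f-inj) p (q - f zero)
      (λ i∈p → Subₚ.x∈p∧x≢y⇒x∈p-y (p→q (there i∈p)) (λ eq → Finₚ.0≢1+n (sym (f-inj eq))))

choose : ∀ {m ℓ} (p : Subset m) → ℓ ≤ ∣ p ∣ →
  Σ (Fin ℓ → Fin m) λ f → Injective _≡_ _≡_ f × (∀ i → f i ∈ p)
choose p ℓ≤∣p∣ =
  enum p ∘ (λ i → Fin.inject≤ i ℓ≤∣p∣) ,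
  (λ eq → Finₚ.inject≤-injective ℓ≤∣p∣ ℓ≤∣p∣ _ _ (enum-injective p eq)) ,
  (λ i → enum-∈ p _)
  where
    enum : ∀ {m} (p : Subset m) → Fin ∣ p ∣ → Fin m
    enum (true ∷ p) zero = zero
    enum (true ∷ p) (suc i) = suc (enum p i)
    enum (false ∷ p) i = suc (enum p i)

    enum-∈ : ∀ {m} (p : Subset m) i → enum p i ∈ p
    enum-∈ (true ∷ p) zero = here
    enum-∈ (true ∷ p) (suc i) = there (enum-∈ p i)
    enum-∈ (false ∷ p) i = there (enum-∈ p i)

    enum-injective : ∀ {m} (p : Subset m) → Injective _≡_ _≡_ (enum p)
    enum-injective (true ∷ p) {zero} {zero} eq = refl
    enum-injective (true ∷ p) {suc i} {suc j} eq =
      cong suc (enum-injective p (Finₚ.suc-injective eq))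
    enum-injective (false ∷ p) eq = enum-injective p (Finₚ.suc-injective eq)

∣p∪q∣≤∣p∣+∣q∣ : ∀ {m} (p q : Subset m) → ∣ p ∪ q ∣ ≤ ∣ p ∣ + ∣ q ∣
∣p∪q∣≤∣p∣+∣q∣ [] [] = z≤n
∣p∪q∣≤∣p∣+∣q∣ (true ∷ p) (true ∷ q) =
  s≤s (ℕₚ.≤-trans (∣p∪q∣≤∣p∣+∣q∣ p q) (ℕₚ.+-monoʳ-≤ ∣ p ∣ (ℕₚ.n≤1+n ∣ q ∣)))
∣p∪q∣≤∣p∣+∣q∣ (true ∷ p) (false ∷ q) = s≤s (∣p∪q∣≤∣p∣+∣q∣ p q)
∣p∪q∣≤∣p∣+∣q∣ (false ∷ p) (true ∷ q) =
  subst (suc ∣ p ∪ q ∣ ≤_) (sym (ℕₚ.+-suc ∣ p ∣ ∣ q ∣)) (s≤s (∣p∪q∣≤∣p∣+∣q∣ p q))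
∣p∪q∣≤∣p∣+∣q∣ (false ∷ p) (false ∷ q) = ∣p∪q∣≤∣p∣+∣q∣ p q

⋃[_] : ∀ {m} k → (Fin k → Subset m) → Subset m
⋃[ zero ] f = ⊥
⋃[ suc k ] f = f zero ∪ ⋃[ k ] (f ∘ suc)

∈⋃⁺ : ∀ {m} k (f : Fin k → Subset m) c {x} → x ∈ f c → x ∈ ⋃[ k ] f
∈⋃⁺ (suc k) f zero x∈ = Subₚ.x∈p∪q⁺ (inj₁ x∈)
∈⋃⁺ (suc k) f (suc c) x∈ = Subₚ.x∈p∪q⁺ (inj₂ (∈⋃⁺ k (f ∘ suc) c x∈))

∈⋃⁻ : ∀ {m} k (f : Fin k → Subset m) {x} → x ∈ ⋃[ k ] f → ∃ λ c → x ∈ f c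
∈⋃⁻ zero f x∈ = contradiction x∈ Subₚ.∉⊥
∈⋃⁻ (suc k) f x∈ with Subₚ.x∈p∪q⁻ (f zero) _ x∈
... | inj₁ x∈f₀ = zero , x∈f₀
... | inj₂ x∈rest with ∈⋃⁻ k (f ∘ suc) x∈rest
...   | c , x∈fc = suc c , x∈fc

∣⋃∣≤ : ∀ {m} k (f : Fin k → Subset m) B → (∀ c → ∣ f c ∣ ≤ B) → ∣ ⋃[ k ] f ∣ ≤ k * B
∣⋃∣≤ {m} zero f B bound = ℕₚ.≤-reflexive (Subₚ.∣⊥∣≡0 m)
∣⋃∣≤ (suc k) f B bound =
  ℕₚ.≤-trans (∣p∪q∣≤∣p∣+∣q∣ (f zero) _)
             (ℕₚ.+-mono-≤ (bound zero) (∣⋃∣≤ k (f ∘ suc) B (bound ∘ suc)))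

switch-off : ∀ {P : ℕ → Set} → (∀ j → Dec (P j)) → ∀ {a b} → a ≤ b → P a → ¬ P b →
  ∃ λ j → a ≤ j × j < b × P j × ¬ P (suc j)
switch-off P? {b = zero} z≤n pa ¬pb = contradiction pa ¬pb
switch-off {P} P? {a} {suc b} a≤1+b pa ¬p1+b with ℕₚ.m≤n⇒m<n∨m≡n a≤1+b | P? b
... | inj₂ refl | _ = contradiction pa ¬p1+b
... | inj₁ a<1+b | yes pb = b , ℕₚ.m<1+n⇒m≤n a<1+b , ℕₚ.≤-refl , pb , ¬p1+b
... | inj₁ a<1+b | no ¬pb with switch-off P? (ℕₚ.m<1+n⇒m≤n a<1+b) pa ¬pb
...   | j , a≤j , j<b , pj , ¬p1+j = j , a≤j , ℕₚ.m<n⇒m<1+n j<b , pj , ¬p1+j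

biclique : (H : Graph) {ℓ : ℕ} (A B : Subset (Graph.n H)) → ℓ ≤ ∣ A ∣ → ℓ ≤ ∣ B ∣ →
  (∀ {a b} → a ∈ A → b ∈ B → a ≢ b × Graph.adj H a b ≡ true) → HasKll H ℓ
biclique H A B ℓ≤∣A∣ ℓ≤∣B∣ joined
  with choose A ℓ≤∣A∣ | choose B ℓ≤∣B∣
... | a , a-inj , a∈A | b , b-inj , b∈B =
  a , b , (λ i j → a-inj) , (λ i j → b-inj) ,
  (λ i j → proj₁ (joined (a∈A i) (b∈B j))) , (λ i j → proj₂ (joined (a∈A i) (b∈B j)))

IsIso : (H H′ : Graph) → Permutation (Graph.n H) (Graph.n H′) → Set
IsIso H H′ π = ∀ u v → Graph.adj H′ (π ⟨$⟩ʳ u) (π ⟨$⟩ʳ v) ≡ Graph.adj H u v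

module _ {H H′ : Graph} {π : Permutation (Graph.n H) (Graph.n H′)} (iso : IsIso H H′ π) where

  private
    π⁻¹ : Fin (Graph.n H′) → Fin (Graph.n H)
    π⁻¹ = π ⟨$⟩ˡ_

    π-injective : Injective _≡_ _≡_ (π ⟨$⟩ʳ_)
    π-injective {x} {y} eq = trans (sym (inverseˡ π)) (trans (cong π⁻¹ eq) (inverseˡ π))

    π⁻¹-injective : Injective _≡_ _≡_ π⁻¹
    π⁻¹-injective {x} {y} eq = trans (sym (inverseʳ π)) (trans (cong (π ⟨$⟩ʳ_) eq) (inverseʳ π))

    adj-π⁻¹ : ∀ u v → Graph.adj H (π⁻¹ u) (π⁻¹ v) ≡ Graph.adj H′ u v
    adj-π⁻¹ u v = trans (sym (iso (π⁻¹ u) (π⁻¹ v))) (cong₂ (Graph.adj H′) (inverseʳ π) (inverseʳ π))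

  kll-pullback : ∀ {ℓ} → HasKll H′ ℓ → HasKll H ℓ
  kll-pullback (a , b , a-inj , b-inj , a≢b , ab) =
    π⁻¹ ∘ a , π⁻¹ ∘ b ,
    (λ i j → a-inj i j ∘ π⁻¹-injective) , (λ i j → b-inj i j ∘ π⁻¹-injective) ,
    (λ i j → a≢b i j ∘ π⁻¹-injective) , (λ i j → trans (adj-π⁻¹ (a i) (b j)) (ab i j))

  pw-pullback : ∀ {w} → PW≤ H′ w → PW≤ H w
  pw-pullback D = record
    { r = r
    ; bag = bag′
    ; cover = λ v → let (i , πv∈) = cover (π ⟨$⟩ʳ v) in i , ∈⟪⟫⁺ (mem i) πv∈
    ; edges = λ u v uv → let (i , πu∈ , πv∈) = edges _ _ (trans (iso u v) uv)
                         in i , ∈⟪⟫⁺ (mem i) πu∈ , ∈⟪⟫⁺ (mem i) πv∈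
    ; interp = λ i j l i<j j<l v v∈i v∈l →
        ∈⟪⟫⁺ (mem j) (interp i j l i<j j<l _ (∈⟪⟫⁻ (mem i) v∈i) (∈⟪⟫⁻ (mem l) v∈l))
    ; width = λ i → ℕₚ.≤-trans
        (∣p∣≤∣q∣-injection _ π-injective (bag′ i) (bag i) (∈⟪⟫⁻ (mem i))) (width i)
    }
    where
      open PathDecomp D
      mem : ∀ i v → Dec ((π ⟨$⟩ʳ v) ∈ bag i)
      mem i v = (π ⟨$⟩ʳ v) Subₚ.∈? bag i
      bag′ : Fin r → Subset (Graph.n H)
      bag′ i = ⟪ mem i ⟫

uadj-sym : ∀ {k m} (e : UExpr k m) u w → uadj e u w ≡ uadj e w u
uadj-sym (single a) u w = refl
uadj-sym (add e S a) zero zero = refl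
uadj-sym (add e S a) zero (suc w) = refl
uadj-sym (add e S a) (suc u) zero = refl
uadj-sym (add e S a) (suc u) (suc w) = uadj-sym e u w
uadj-sym (relab R e) u w = uadj-sym e u w

uadj-loopless : ∀ {k m} (e : UExpr k m) u → uadj e u u ≡ false
uadj-loopless (single a) u = refl
uadj-loopless (add e S a) zero = refl
uadj-loopless (add e S a) (suc u) = uadj-loopless e u
uadj-loopless (relab R e) u = uadj-loopless e u

⟦_⟧ : ∀ {k m} → UExpr k m → Graph
⟦_⟧ {m = m} e = record { n = m ; adj = uadj e ; sym = uadj-sym e ; loopless = uadj-loopless e }

-- labelAt e j y: the label of y at stage j, i.e. in the subexpression that
-- builds exactly the vertices of index ≥ j (for j ≥ 1: just before vertex
-- j - 1 is added).  Stage 0 is the whole expression.  The value is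
-- meaningless unless j ≤ toℕ y.
labelAt : ∀ {k m} → UExpr k m → ℕ → Fin m → Fin k
labelAt e zero y = ulabel e y
labelAt (single a) (suc j) y = a
labelAt (add e S a) (suc j) zero = a
labelAt (add e S a) (suc j) (suc y) = labelAt e j y
labelAt (relab R e) (suc j) y = labelAt e (suc j) y

-- Relabelings are functions: vertices sharing a label at stage j share it
-- at every later stage j′ ≤ j.
labelAt-later : ∀ {k m} (e : UExpr k m) {j′ j} (y y′ : Fin m) → j′ ≤ j →
  j ≤ toℕ y → j ≤ toℕ y′ → labelAt e j y ≡ labelAt e j y′ → labelAt e j′ y ≡ labelAt e j′ y′
labelAt-later e {zero} {zero} y y′ _ _ _ same = same
labelAt-later (single a) {zero} {suc j} zero zero _ () _ _
labelAt-later (add e S a) {zero} {suc j} (suc y) (suc y′) _ (s≤s j≤y) (s≤s j≤y′) same =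
  labelAt-later e y y′ z≤n j≤y j≤y′ same
labelAt-later (relab R e) {zero} {suc j} y y′ _ j≤y j≤y′ same =
  cong R (labelAt-later e y y′ z≤n j≤y j≤y′ same)
labelAt-later (single a) {suc j′} {suc j} y y′ _ _ _ _ = refl
labelAt-later (add e S a) {suc j′} {suc j} (suc y) (suc y′) (s≤s j′≤j) (s≤s j≤y) (s≤s j≤y′) same =
  labelAt-later e y y′ j′≤j j≤y j≤y′ same
labelAt-later (relab R e) {suc j′} {suc j} y y′ j′≤j j≤y j≤y′ same =
  labelAt-later e y y′ j′≤j j≤y j≤y′ same

adj-by-label : ∀ {k m} (e : UExpr k m) {j} (z y y′ : Fin m) → toℕ z < j →
  j ≤ toℕ y → j ≤ toℕ y′ → labelAt e j y ≡ labelAt e j y′ → uadj e z y ≡ uadj e z y′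
adj-by-label (single a) {suc j} zero zero zero _ _ _ _ = refl
adj-by-label (add e S a) {suc j} zero (suc y) (suc y′) _ (s≤s j≤y) (s≤s j≤y′) same =
  cong (λ c → S c a) (labelAt-later e y y′ z≤n j≤y j≤y′ same)
adj-by-label (add e S a) {suc j} (suc z) (suc y) (suc y′) (s≤s z<j) (s≤s j≤y) (s≤s j≤y′) same =
  adj-by-label e z y y′ z<j j≤y j≤y′ same
adj-by-label (relab R e) {suc j} z y y′ z<j j≤y j≤y′ same = adj-by-label e z y y′ z<j j≤y j≤y′ same

module Separators {k m : ℕ} (e : UExpr k m) (t : ℕ) (noK : ¬ HasKll ⟦ e ⟧ (suc t)) where

  InClass : ℕ → Fin k → Fin m → Set
  InClass j c y = j ≤ toℕ y × labelAt e j y ≡ c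

  inClass? : ∀ j c y → Dec (InClass j c y)
  inClass? j c y = (j ℕ.≤? toℕ y) ×-dec (labelAt e j y Fin.≟ c)

  Class : ℕ → Fin k → Subset m
  Class j c = ⟪ inClass? j c ⟫

  ∈Class⁻ : ∀ {j c y} → y ∈ Class j c → InClass j c y
  ∈Class⁻ {j} {c} = ∈⟪⟫⁻ (inClass? j c)

  ∈Class⁺ : ∀ {j c y} → InClass j c y → y ∈ Class j c
  ∈Class⁺ {j} {c} = ∈⟪⟫⁺ (inClass? j c)

  Sees : ℕ → Fin k → Fin m → Set
  Sees j c z = toℕ z < j × (∀ y → y ∈ Class j c → uadj e z y ≡ true)

  sees? : ∀ j c z → Dec (Sees j c z)
  sees? j c z = (toℕ z ℕ.<? j) ×-dec Finₚ.all? (λ y → (y Subₚ.∈? Class j c) →-dec (uadj e z y Boolₚ.≟ true))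

  Watchers : ℕ → Fin k → Subset m
  Watchers j c = ⟪ sees? j c ⟫

  Small : ℕ → Fin k → Set
  Small j c = ∣ Class j c ∣ ≤ t

  small? : ∀ j c → Dec (Small j c)
  small? j c = ∣ Class j c ∣ ℕ.≤? t

  -- K_{t+1,t+1}-freeness: a large class has few watchers.
  few-watchers : ∀ j c → ¬ Small j c → ∣ Watchers j c ∣ ≤ t
  few-watchers j c big with ∣ Watchers j c ∣ ℕ.≤? t
  ... | yes few = few
  ... | no many = contradiction (biclique ⟦ e ⟧ (Watchers j c) (Class j c)
                                   (ℕₚ.≰⇒> many) (ℕₚ.≰⇒> big) joined) noK
    where
      joined : ∀ {z y} → z ∈ Watchers j c → y ∈ Class j c → z ≢ y × uadj e z y ≡ true
      joined z∈ y∈ with ∈⟪⟫⁻ (sees? j c) z∈ | ∈Class⁻ y∈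
      ... | z<j , sees | j≤y , _ =
        (λ { refl → ℕₚ.<⇒≱ z<j j≤y }) , sees _ y∈

  Contributes : ℕ → Fin k → Fin m → Set
  Contributes j c v = (Small j c × InClass j c v) ⊎ (¬ Small j c × Sees j c v)

  contributes? : ∀ j c v → Dec (Contributes j c v)
  contributes? j c v = (small? j c ×-dec inClass? j c v) ⊎-dec (¬? (small? j c) ×-dec sees? j c v)

  Contribution : ℕ → Fin k → Subset m
  Contribution j c = ⟪ contributes? j c ⟫

  some-member : ∀ {j c} → ¬ Small j c → ∃ λ y → y ∈ Class j c
  some-member {j} {c} big =
    let (f , _ , f∈) = choose (Class j c) (ℕₚ.≤-trans (s≤s z≤n) (ℕₚ.≰⇒> big)) in f zero , f∈ zero

  ∣Contribution∣≤t : ∀ j c → ∣ Contribution j c ∣ ≤ t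
  ∣Contribution∣≤t j c with small? j c
  ... | yes small = ℕₚ.≤-trans (Subₚ.p⊆q⇒∣p∣≤∣q∣ ⊆class) small
    where
      ⊆class : Contribution j c ⊆ Class j c
      ⊆class v∈ with ∈⟪⟫⁻ (contributes? j c) v∈
      ... | inj₁ (_ , inClass) = ∈Class⁺ inClass
      ... | inj₂ (big , _) = contradiction small big
  ... | no big = ℕₚ.≤-trans (Subₚ.p⊆q⇒∣p∣≤∣q∣ ⊆watchers) (few-watchers j c big)
    where
      ⊆watchers : Contribution j c ⊆ Watchers j c
      ⊆watchers v∈ with ∈⟪⟫⁻ (contributes? j c) v∈
      ... | inj₁ (small , _) = contradiction small big
      ... | inj₂ (_ , sees) = ∈⟪⟫⁺ (sees? j c) sees

  Sep : ℕ → Subset m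
  Sep j = ⋃[ k ] (Contribution j)

  ∣Sep∣≤ : ∀ j → ∣ Sep j ∣ ≤ k * t
  ∣Sep∣≤ j = ∣⋃∣≤ k (Contribution j) t (∣Contribution∣≤t j)

  ∈Sep⁺ : ∀ {j v} c → Contributes j c v → v ∈ Sep j
  ∈Sep⁺ {j} c contributes = ∈⋃⁺ k (Contribution j) c (∈⟪⟫⁺ (contributes? j c) contributes)

  ∈Sep⁻ : ∀ {j v} → v ∈ Sep j → ∃ λ c → Contributes j c v
  ∈Sep⁻ {j} v∈ = let (c , v∈c) = ∈⋃⁻ k (Contribution j) v∈ in c , ∈⟪⟫⁻ (contributes? j c) v∈c

  class-grows : ∀ {j′ j c y} → j′ ≤ j → InClass j c y → Class j c ⊆ Class j′ (labelAt e j′ y)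
  class-grows {j′} {j} {c} {y} j′≤j (j≤y , refl) {y′} y′∈ with ∈Class⁻ y′∈
  ... | j≤y′ , same = ∈Class⁺ (ℕₚ.≤-trans j′≤j j≤y′ , labelAt-later e y′ y j′≤j j≤y′ j≤y same)

  -- A vertex in the separator at stage j that is newer than stage j′ ≤ j
  -- stays in the separator at stage j′: it watches a large class, which
  -- lies inside a (hence large) class at stage j′ that it still watches.
  sep-newer : ∀ {j′ j v} → toℕ v < j′ → j′ ≤ j → v ∈ Sep j → v ∈ Sep j′
  sep-newer {j′} {j} {v} v<j′ j′≤j v∈ with ∈Sep⁻ v∈
  ... | c , inj₁ (_ , j≤v , _) = contradiction (ℕₚ.<-≤-trans v<j′ j′≤j) (ℕₚ.≤⇒≯ j≤v)
  ... | c , inj₂ (big , _ , sees) = ∈Sep⁺ c′ (inj₂ (big′ , v<j′ , sees′))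
    where
      y : Fin m
      y = proj₁ (some-member {j} {c} big)
      y∈ : y ∈ Class j c
      y∈ = proj₂ (some-member {j} {c} big)
      c′ : Fin k
      c′ = labelAt e j′ y
      grows : Class j c ⊆ Class j′ c′
      grows = class-grows j′≤j (∈Class⁻ y∈)
      big′ : ¬ Small j′ c′
      big′ small′ = big (ℕₚ.≤-trans (Subₚ.p⊆q⇒∣p∣≤∣q∣ grows) small′)
      sees′ : ∀ y′ → y′ ∈ Class j′ c′ → uadj e v y′ ≡ true
      sees′ y′ y′∈ with ∈Class⁻ y′∈ | ∈Class⁻ y∈
      ... | j′≤y′ , same | j≤y , _ =
        trans (adj-by-label e v y′ y v<j′ j′≤y′ (ℕₚ.≤-trans j′≤j j≤y) same) (sees y y∈)

  -- A vertex in the separator at stage j that is present at the older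
  -- stage j′ ≥ j stays in the separator there: its small class at stage j
  -- contains its class at stage j′.
  sep-older : ∀ {j j′ v} → j ≤ j′ → j′ ≤ toℕ v → v ∈ Sep j → v ∈ Sep j′
  sep-older {j} {j′} {v} j≤j′ j′≤v v∈ with ∈Sep⁻ v∈
  ... | c , inj₂ (_ , v<j , _) = contradiction (ℕₚ.<-≤-trans v<j (ℕₚ.≤-trans j≤j′ j′≤v)) (ℕₚ.<-irrefl refl)
  ... | c , inj₁ (small , j≤v , refl) = ∈Sep⁺ c′ (inj₁ (small′ , j′≤v , refl))
    where
      c′ : Fin k
      c′ = labelAt e j′ v
      small′ : Small j′ c′
      small′ = ℕₚ.≤-trans (Subₚ.p⊆q⇒∣p∣≤∣q∣ (class-grows j≤j′ (j′≤v , refl))) small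

  InBag : ℕ → Fin m → Set
  InBag j v = toℕ v ≡ j ⊎ v ∈ Sep j ⊎ v ∈ Sep (suc j)

  Large : Fin m → ℕ → Set
  Large y j = j ≤ toℕ y × ¬ Small j (labelAt e j y)

  large? : ∀ y j → Dec (Large y j)
  large? y j = (j ℕ.≤? toℕ y) ×-dec ¬? (small? j (labelAt e j y))

  -- If the class of y at stage z+1 is small, y ∈ Sep (z+1).  Otherwise
  -- switch-off yields a stage j ∈ [z+1, toℕ y] where the class of y is
  -- large but is small at j+1 (or y = j): there z watches the class of y,
  -- and y is vertex j or lies in Sep (j+1).
  edge-in-bag : ∀ {z y} → toℕ z < toℕ y → uadj e z y ≡ true →
    ∃ λ j → j ≤ toℕ y × InBag j z × InBag j y
  edge-in-bag {z} {y} z<y zy with small? (suc (toℕ z)) (labelAt e (suc (toℕ z)) y)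
  ... | yes small = toℕ z , ℕₚ.<⇒≤ z<y , inj₁ refl , inj₂ (inj₂ (∈Sep⁺ _ (inj₁ (small , z<y , refl))))
  ... | no big with switch-off (large? y) (ℕₚ.m≤n⇒m≤1+n z<y) (z<y , big) (λ (1+y≤y , _) → ℕₚ.n≮n (toℕ y) 1+y≤y)
  ...   | j , z<j , j<1+y , (j≤y , big-j) , ¬large-1+j =
    j , j≤y , inj₂ (inj₁ z∈) , y∈
    where
      z∈ : z ∈ Sep j
      z∈ = ∈Sep⁺ _ (inj₂ (big-j , z<j , λ y′ y′∈ → trans (adj-by-label e z y′ y z<j
             (proj₁ (∈Class⁻ {j} y′∈)) j≤y (proj₂ (∈Class⁻ {j} y′∈))) zy))
      y∈ : InBag j y
      y∈ with ℕₚ.m≤n⇒m<n∨m≡n j≤y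
      ... | inj₂ j≡y = inj₁ (sym j≡y)
      ... | inj₁ j<y with small? (suc j) (labelAt e (suc j) y)
      ...   | yes small = inj₂ (inj₂ (∈Sep⁺ _ (inj₁ (small , j<y , refl))))
      ...   | no big′ = contradiction (j<y , big′) ¬large-1+j

  bag-interval : ∀ {i j l v} → i < j → j < l → InBag i v → InBag l v → InBag j v
  bag-interval {i} {j} {l} {v} i<j j<l v∈i v∈l with ℕₚ.<-cmp (toℕ v) j
  ... | tri≈ _ v≡j _ = inj₁ v≡j
  ... | tri< v<j _ _ = inj₂ (inj₂ (newer v∈l))
    where
      newer : InBag l v → v ∈ Sep (suc j)
      newer (inj₁ refl) = contradiction (ℕₚ.<-trans v<j j<l) (ℕₚ.<-irrefl refl)
      newer (inj₂ (inj₁ v∈)) = sep-newer (s≤s (ℕₚ.<⇒≤ v<j)) j<l v∈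
      newer (inj₂ (inj₂ v∈)) = sep-newer (s≤s (ℕₚ.<⇒≤ v<j)) (ℕₚ.m≤n⇒m≤1+n j<l) v∈
  ... | tri> _ _ j<v = inj₂ (inj₂ (older v∈i))
    where
      older : InBag i v → v ∈ Sep (suc j)
      older (inj₁ refl) = contradiction (ℕₚ.<-trans i<j j<v) (ℕₚ.<-irrefl refl)
      older (inj₂ (inj₁ v∈)) = sep-older (ℕₚ.m<n⇒m≤1+n i<j) j<v v∈
      older (inj₂ (inj₂ v∈)) = sep-older (s≤s (ℕₚ.<⇒≤ i<j)) j<v v∈

  Bag : Fin m → Subset m
  Bag x = ⁅ x ⁆ ∪ (Sep (toℕ x) ∪ Sep (suc (toℕ x)))

  ∈Bag⁺ : ∀ {x v} → InBag (toℕ x) v → v ∈ Bag x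
  ∈Bag⁺ {x} (inj₁ v≡x) = Subₚ.x∈p∪q⁺ (inj₁ (subst (_∈ ⁅ x ⁆) (sym (Finₚ.toℕ-injective v≡x)) (Subₚ.x∈⁅x⁆ x)))
  ∈Bag⁺ (inj₂ v∈) = Subₚ.x∈p∪q⁺ (inj₂ (Subₚ.x∈p∪q⁺ v∈))

  ∈Bag⁻ : ∀ {x v} → v ∈ Bag x → InBag (toℕ x) v
  ∈Bag⁻ {x} v∈ with Subₚ.x∈p∪q⁻ ⁅ x ⁆ _ v∈
  ... | inj₁ v∈x = inj₁ (cong toℕ (Subₚ.x∈⁅y⁆⇒x≡y x v∈x))
  ... | inj₂ v∈seps = inj₂ (Subₚ.x∈p∪q⁻ _ _ v∈seps)

  ∣Bag∣≤ : ∀ x → ∣ Bag x ∣ ≤ suc (2 * k * t)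
  ∣Bag∣≤ x = begin
    ∣ Bag x ∣                                        ≤⟨ ∣p∪q∣≤∣p∣+∣q∣ ⁅ x ⁆ _ ⟩
    ∣ ⁅ x ⁆ ∣ + ∣ Sep (toℕ x) ∪ Sep (suc (toℕ x)) ∣ ≤⟨ ℕₚ.+-mono-≤ (ℕₚ.≤-reflexive (Subₚ.∣⁅x⁆∣≡1 x))
                                                            (∣p∪q∣≤∣p∣+∣q∣ (Sep (toℕ x)) _) ⟩
    1 + (∣ Sep (toℕ x) ∣ + ∣ Sep (suc (toℕ x)) ∣)    ≤⟨ s≤s (ℕₚ.+-mono-≤ (∣Sep∣≤ (toℕ x)) (∣Sep∣≤ (suc (toℕ x)))) ⟩
    1 + (k * t + k * t)                              ≡⟨ cong suc twice ⟩
    suc (2 * k * t)                                  ∎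
    where
      open ℕₚ.≤-Reasoning
      twice : k * t + k * t ≡ 2 * k * t
      twice = sym (trans (ℕₚ.*-assoc 2 k t) (cong (k * t +_) (ℕₚ.+-identityʳ (k * t))))

  decomposition : PathDecomp ⟦ e ⟧ (2 * k * t)
  decomposition = record
    { r = m
    ; bag = Bag
    ; cover = λ v → v , ∈Bag⁺ (inj₁ refl)
    ; edges = edges
    ; interp = λ i j l i<j j<l v v∈i v∈l → ∈Bag⁺ (bag-interval i<j j<l (∈Bag⁻ v∈i) (∈Bag⁻ v∈l))
    ; width = ∣Bag∣≤
    }
    where
      both : ∀ {z y} → toℕ z < toℕ y → uadj e z y ≡ true → ∃ λ x → z ∈ Bag x × y ∈ Bag x
      both {z} {y} z<y zy with edge-in-bag z<y zy
      ... | j , j≤y , z∈ , y∈ = x , ∈Bag⁺ (inBag-x z∈) , ∈Bag⁺ (inBag-x y∈)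
        where
          j<m : j < m
          j<m = ℕₚ.≤-<-trans j≤y (Finₚ.toℕ<n y)
          x : Fin m
          x = Fin.fromℕ< j<m
          inBag-x : ∀ {v} → InBag j v → InBag (toℕ x) v
          inBag-x {v} = subst (λ i → InBag i v) (sym (Finₚ.toℕ-fromℕ< j<m))
      edges : ∀ u v → uadj e u v ≡ true → ∃ λ x → u ∈ Bag x × v ∈ Bag x
      edges u v uv with ℕₚ.<-cmp (toℕ u) (toℕ v)
      ... | tri< u<v _ _ = both u<v uv
      ... | tri> _ _ v<u = let (x , v∈ , u∈) = both v<u (trans (uadj-sym e v u) uv) in x , u∈ , v∈
      ... | tri≈ _ u≡v _ with Finₚ.toℕ-injective u≡v
      ...   | refl = contradiction (trans (sym uv) (uadj-loopless e u)) (λ ())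

pw≤lnlcw : (H : Graph) (t : ℕ) → ¬ HasKll H (suc t) → ∀ k → LNLCW≤ H k → PW≤ H (2 * k * t)
pw≤lnlcw H t noK k (e , π , iso) =
  pw-pullback {H} {⟦ e ⟧} {π} iso (Separators.decomposition e t noK-e)
  where
    noK-e : ¬ HasKll ⟦ e ⟧ (suc t)
    noK-e kll = noK (kll-pullback {H} {⟦ e ⟧} {π} iso {suc t} kll)

pw-un⇒dpw : (G : Digraph) → ∀ w → PW≤ (un G) w → DPW≤ G w
pw-un⇒dpw G w D = record
  { r = r
  ; bag = bag
  ; cover = cover
  ; arcs = λ u v uv → let (i , u∈ , v∈) = edges u v (cong (_∨ Digraph.arc G v u) uv)
                      in i , i , Finₚ.≤-refl , u∈ , v∈
  ; interp = interp
  ; width = width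
  }
  where open PathDecomp D

undirect : ∀ {k m} → DExpr k m → UExpr k m
undirect (single a) = single a
undirect (add e Sf Sb a) = add (undirect e) (λ b c → Sf b c ∨ Sb b c) a
undirect (relab R e) = relab R (undirect e)

undirect-label : ∀ {k m} (e : DExpr k m) u → ulabel (undirect e) u ≡ dlabel e u
undirect-label (single a) zero = refl
undirect-label (add e Sf Sb a) zero = refl
undirect-label (add e Sf Sb a) (suc u) = undirect-label e u
undirect-label (relab R e) u = cong R (undirect-label e u)

undirect-adj : ∀ {k m} (e : DExpr k m) u w → uadj (undirect e) u w ≡ (darc e u w ∨ darc e w u)
undirect-adj (single a) u w = refl
undirect-adj (add e Sf Sb a) zero zero = refl
undirect-adj (add e Sf Sb a) zero (suc w) rewrite undirect-label e w =
  Boolₚ.∨-comm (Sf (dlabel e w) a) (Sb (dlabel e w) a)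
undirect-adj (add e Sf Sb a) (suc u) zero rewrite undirect-label e u = refl
undirect-adj (add e Sf Sb a) (suc u) (suc w) = undirect-adj e u w
undirect-adj (relab R e) u w = undirect-adj e u w

dlnlcw⇒lnlcw : (G : Digraph) → ∀ k → DLNLCW≤ G k → LNLCW≤ (un G) k
dlnlcw⇒lnlcw G k (e , π , iso) =
  undirect e , π , λ u v → trans (undirect-adj e _ _) (cong₂ _∨_ (iso u v) (iso v u))

corollary5p16 : (ℓ : ℕ) → 1 ≤ ℓ → (G : Digraph) → ¬ HasKll (un G) ℓ →
    (∀ k → PW≤ (un G) k → DPW≤ G k)
    × (∀ k → LNLCW≤ (un G) k → PW≤ (un G) (2 * k * (ℓ ∸ 1)))
    × (∀ k → DLNLCW≤ G k → ∃ λ k′ → LNLCW≤ (un G) k′ × (2 * k′ * (ℓ ∸ 1) ≤ 2 * k * (ℓ ∸ 1)))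
corollary5p16 (suc t) (s≤s z≤n) G noK =
  pw-un⇒dpw G ,
  pw≤lnlcw (un G) t noK ,
  (λ k expr → k , dlnlcw⇒lnlcw G k expr , ℕₚ.≤-refl)
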